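{- Let $k\ge 1$ and let $f$ be a Dyck word of length $2k$, with Dyck nest $F=F(f)=F_1F_2\cdots F_{2k}$. Then $F$ contains the substring $kk$, i.e. there is an index $i$ with $F_i=F_{i+1}=k$.
   Context: A Dyck word of length $2k$ is a binary string $f=f_1\cdots f_{2k}$ with exactly $k$ ones such that every prefix of $f$ contains at least as many 0-bits as 1-bits. Its Dyck path is the lattice path from height $0$ obtained by reading $f$ from left to right and replacing each 0-bit by an up-step $(x,y)\to(x+1,y+1)$ and each 1-bit by a down-step $(x,y)\to(x+1,y-1)$. The Dyck nest $F(f)=F_1\cdots F_{2k}$ is the string obtained by assigning the integers $1,2,\ldots,k$ successively to the steps as follows: one processes the horizontal unit layers $[y,y+1]$ for $y=0,1,2,\ldots$ in increasing order, and within each layer one assigns consecutive integers (continuing the count from the previous layers) to the up-steps of that layer from right to left, and likewise to the down-steps of that layer from right to left (so the $t$-th up-step and the $t$-th down-step processed receive the same integer); $F_i$ is the integer assigned to the $i$-th step. Each integer in $[1,k]$ appears exactly twice in $F$. -}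

module Defs where

open import Data.Bool using (Bool; true; false; if_then_else_; _∧_; _∨_)
open import Data.Nat using (ℕ; zero; suc; _+_; _*_; _∸_; _≤_; _<ᵇ_; _≡ᵇ_; _≤ᵇ_)
open import Data.List using (List; []; _∷_; length; take; upTo)
open import Relation.Binary.PropositionalEquality using (_≡_)

-- Bits: false = 0-bit (up-step), true = 1-bit (down-step).

_==ᵇ_ : Bool → Bool → Bool
false ==ᵇ false = true
true  ==ᵇ true  = true
_     ==ᵇ _     = false

count : Bool → List Bool → ℕ
count b []       = 0
count b (x ∷ xs) = if x ==ᵇ b then suc (count b xs) else count b xs

record IsDyckWord (k : ℕ) (f : List Bool) : Set where
  field
    len      : length f ≡ 2 * k
    ones     : count true f ≡ k
    prefixes : ∀ n → count true (take n f) ≤ count false (take n f)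

-- i-th bit (0-indexed); default value outside the word is irrelevant
bitAt : List Bool → ℕ → Bool
bitAt []       _       = false
bitAt (x ∷ xs) zero    = x
bitAt (x ∷ xs) (suc i) = bitAt xs i

heightBefore : List Bool → ℕ → ℕ
heightBefore f i = count false (take i f) ∸ count true (take i f)

-- the layer [y, y+1] occupied by step i is given by y = layer f i:
-- an up-step starting at height h occupies [h, h+1],
-- a down-step starting at height h occupies [h-1, h].
layer : List Bool → ℕ → ℕ
layer f i = if bitAt f i then heightBefore f i ∸ 1 else heightBefore f i

countBelow : ℕ → (ℕ → Bool) → ℕ
countBelow zero    p = 0
countBelow (suc n) p = (if p n then 1 else 0) + countBelow n p

-- Step j precedes step i in the labelling order among steps of the same
-- type: layers are processed bottom-up, and within a layer right to left.
-- (j = i counts as preceding, so labels start from 1.)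
labelledNoLaterThan : List Bool → ℕ → ℕ → Bool
labelledNoLaterThan f i j =
  (bitAt f j ==ᵇ bitAt f i) ∧
  ((layer f j <ᵇ layer f i) ∨ ((layer f j ≡ᵇ layer f i) ∧ (i ≤ᵇ j)))

-- Dyck nest: nest f i = F_{i+1}, the integer assigned to the (i+1)-th step
-- (0-indexed position i).  The t-th up-step processed and the t-th
-- down-step processed both receive the integer t.
nest : List Bool → ℕ → ℕ
nest f i = countBelow (length f) (labelledNoLaterThan f i)

{-# OPTIONS --safe #-}
module Submission where

-- Let m be the first position at which the Dyck path reaches its maximal height.
-- Step m−1 is then an up-step and step m a down-step, both in the top layer of
-- the path. Every other up-step lies in a lower layer, or in the same layer but
-- further right, so step m−1 is the last up-step to be labelled and receives k
-- (there are k up-steps); symmetrically step m receives k among the down-steps.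

open import Defs
open import Data.Bool using (Bool; true; false; not; T; if_then_else_; _∧_; _∨_)
open import Data.Bool.Properties using (T-≡; T-∧; T-∨)
open import Data.List using (List; []; _∷_; length; take)
open import Data.List.Properties using (take-all)
open import Data.Nat using (ℕ; zero; suc; _+_; _∸_; _≤_; _<_; _*_; _<ᵇ_; _≡ᵇ_; _≤ᵇ_; z≤n; s≤s; s≤s⁻¹; _<?_)
open import Data.Nat.Properties
open import Data.Product using (∃; _×_; _,_)
open import Data.Sum using (inj₁; inj₂)
open import Data.Empty using (⊥-elim)
open import Function.Bundles using (Equivalence)
open import Relation.Nullary using (yes; no)
open import Relation.Binary.PropositionalEquality
open ≡-Reasoning

count-take-suc : ∀ b (f : List Bool) j → j < length f →
  count b (take (suc j) f) ≡ (if bitAt f j ==ᵇ b then 1 else 0) + count b (take j f)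
count-take-suc b (x ∷ xs) zero _ with x ==ᵇ b
... | true  = refl
... | false = refl
count-take-suc b (x ∷ xs) (suc j) (s≤s j<n) with x ==ᵇ b
... | true  = trans (cong suc (count-take-suc b xs j j<n)) (sym (+-suc _ _))
... | false = count-take-suc b xs j j<n

count-take-suc-hit : ∀ b (f : List Bool) j → j < length f → bitAt f j ≡ b →
  count b (take (suc j) f) ≡ suc (count b (take j f))
count-take-suc-hit false f j j<n e rewrite count-take-suc false f j j<n | e = refl
count-take-suc-hit true  f j j<n e rewrite count-take-suc true  f j j<n | e = refl

count-take-suc-miss : ∀ b (f : List Bool) j → j < length f → bitAt f j ≡ not b →
  count b (take (suc j) f) ≡ count b (take j f)
count-take-suc-miss false f j j<n e rewrite count-take-suc false f j j<n | e = refl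
count-take-suc-miss true  f j j<n e rewrite count-take-suc true  f j j<n | e = refl

count-false+count-true : ∀ xs → count false xs + count true xs ≡ length xs
count-false+count-true []           = refl
count-false+count-true (false ∷ xs) = cong suc (count-false+count-true xs)
count-false+count-true (true ∷ xs)  = trans (+-suc _ _) (cong suc (count-false+count-true xs))

countBelow-cong : ∀ n {p q : ℕ → Bool} → (∀ j → j < n → p j ≡ q j) → countBelow n p ≡ countBelow n q
countBelow-cong zero    p≗q = refl
countBelow-cong (suc n) p≗q =
  cong₂ (λ b c → (if b then 1 else 0) + c) (p≗q n ≤-refl) (countBelow-cong n (λ j j<n → p≗q j (m<n⇒m<1+n j<n)))

countBelow-bitAt : ∀ b (f : List Bool) n → n ≤ length f →
  countBelow n (λ j → bitAt f j ==ᵇ b) ≡ count b (take n f)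
countBelow-bitAt b f zero    _   = refl
countBelow-bitAt b f (suc n) n<l =
  trans (cong ((if bitAt f n ==ᵇ b then 1 else 0) +_) (countBelow-bitAt b f n (<⇒≤ n<l)))
        (sym (count-take-suc b f n n<l))

count-bitAt : ∀ b (f : List Bool) → countBelow (length f) (λ j → bitAt f j ==ᵇ b) ≡ count b f
count-bitAt b f = trans (countBelow-bitAt b f (length f) ≤-refl) (cong (count b) (take-all (length f) f ≤-refl))

==ᵇ-∧-absorb : ∀ a b {x} → (a ≡ b → T x) → ((a ==ᵇ b) ∧ x) ≡ (a ==ᵇ b)
==ᵇ-∧-absorb false false t = Equivalence.to T-≡ (t refl)
==ᵇ-∧-absorb true  true  t = Equivalence.to T-≡ (t refl)
==ᵇ-∧-absorb false true  _ = refl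
==ᵇ-∧-absorb true  false _ = refl

lexicographic-T : ∀ {x y} i j → x ≤ y → (x ≡ y → i ≤ j) → T ((x <ᵇ y) ∨ ((x ≡ᵇ y) ∧ (i ≤ᵇ j)))
lexicographic-T {x} i j x≤y tie with m≤n⇒m<n∨m≡n x≤y
... | inj₁ x<y  = Equivalence.from T-∨ (inj₁ (<⇒<ᵇ x<y))
... | inj₂ refl = Equivalence.from (T-∨ {x <ᵇ x}) (inj₂ (Equivalence.from T-∧ (≡⇒≡ᵇ x x refl , ≤⇒≤ᵇ (tie refl))))

LastOfItsType : List Bool → ℕ → Set
LastOfItsType f i = ∀ j → j < length f → bitAt f j ≡ bitAt f i →
  layer f j ≤ layer f i × (layer f j ≡ layer f i → i ≤ j)

nest-lastOfItsType : ∀ f i → LastOfItsType f i → nest f i ≡ count (bitAt f i) f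
nest-lastOfItsType f i last = begin
  nest f i                                              ≡⟨ countBelow-cong (length f) labelled-iff-sameType ⟩
  countBelow (length f) (λ j → bitAt f j ==ᵇ bitAt f i) ≡⟨ count-bitAt (bitAt f i) f ⟩
  count (bitAt f i) f                                   ∎
  where
  labelled-iff-sameType : ∀ j → j < length f → labelledNoLaterThan f i j ≡ (bitAt f j ==ᵇ bitAt f i)
  labelled-iff-sameType j j<n = ==ᵇ-∧-absorb (bitAt f j) (bitAt f i)
    (λ same → let (below , tie) = last j j<n same in lexicographic-T i j below tie)

layer-up : ∀ f j → bitAt f j ≡ false → layer f j ≡ heightBefore f j
layer-up f j e = cong (λ b → if b then heightBefore f j ∸ 1 else heightBefore f j) e

record FirstMaximum (g : ℕ → ℕ) (N m : ℕ) : Set where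
  field
    bounded : m ≤ N
    maximal : ∀ {j} → j ≤ N → g j ≤ g m
    first   : ∀ {j} → j < m → g j < g m

  ≡-max⇒≥ : ∀ {j} → g j ≡ g m → m ≤ j
  ≡-max⇒≥ e = ≮⇒≥ (λ j<m → <-irrefl e (first j<m))

maximal-extend : ∀ {g : ℕ → ℕ} {N m} → (∀ {j} → j ≤ N → g j ≤ g m) → g (suc N) ≤ g m →
  ∀ {j} → j ≤ suc N → g j ≤ g m
maximal-extend max top j≤1+N with m≤n⇒m<n∨m≡n j≤1+N
... | inj₁ j<1+N = max (s≤s⁻¹ j<1+N)
... | inj₂ refl  = top

firstMaximum : ∀ g N → ∃ (FirstMaximum g N)
firstMaximum g zero = 0 , record { bounded = z≤n ; maximal = λ { z≤n → ≤-refl } ; first = λ () }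
firstMaximum g (suc N) with firstMaximum g N
... | m , fm with g m <? g (suc N)
...   | yes gm<gN = suc N , record
  { bounded = ≤-refl
  ; maximal = maximal-extend (λ j≤N → <⇒≤ (≤-<-trans (maximal j≤N) gm<gN)) ≤-refl
  ; first   = λ j<1+N → ≤-<-trans (maximal (s≤s⁻¹ j<1+N)) gm<gN
  }
  where open FirstMaximum fm
...   | no gm≮gN = m , record
  { bounded = m≤n⇒m≤1+n bounded
  ; maximal = maximal-extend maximal (≮⇒≥ gm≮gN)
  ; first   = first
  }
  where open FirstMaximum fm

module DyckPath {k : ℕ} {f : List Bool} (dw : IsDyckWord k f) where
  open IsDyckWord dw

  H : ℕ → ℕ
  H = heightBefore f

  height-up : ∀ j → j < length f → bitAt f j ≡ false → H (suc j) ≡ suc (H j)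
  height-up j j<n up = begin
    H (suc j)                                            ≡⟨ cong₂ _∸_ (count-take-suc-hit false f j j<n up)
                                                                      (count-take-suc-miss true f j j<n up) ⟩
    suc (count false (take j f)) ∸ count true (take j f) ≡⟨ +-∸-assoc 1 (prefixes j) ⟩
    suc (H j)                                            ∎

  height-down : ∀ j → j < length f → bitAt f j ≡ true → H j ≡ suc (H (suc j))
  height-down j j<n down = begin
    H j                                                        ≡⟨ +-∸-assoc 1 descent-allowed ⟩
    suc (count false (take j f) ∸ suc (count true (take j f))) ≡⟨ cong suc (sym (cong₂ _∸_ false-same true-more)) ⟩
    suc (H (suc j))                                            ∎
    where
    true-more  = count-take-suc-hit true f j j<n down
    false-same = count-take-suc-miss false f j j<n down
    descent-allowed : suc (count true (take j f)) ≤ count false (take j f)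
    descent-allowed = subst₂ _≤_ true-more false-same (prefixes (suc j))

  layer-down : ∀ j → j < length f → bitAt f j ≡ true → layer f j ≡ H (suc j)
  layer-down j j<n down =
    trans (cong (λ b → if b then H j ∸ 1 else H j) down) (cong (_∸ 1) (height-down j j<n down))

  count-false : count false f ≡ k
  count-false = +-cancelʳ-≡ k _ _ (begin
    count false f + k            ≡⟨ cong (count false f +_) (sym ones) ⟩
    count false f + count true f ≡⟨ count-false+count-true f ⟩
    length f                     ≡⟨ len ⟩
    2 * k                        ≡⟨ cong (k +_) (+-identityʳ k) ⟩
    k + k                        ∎)

  height-end : H (length f) ≡ 0
  height-end = begin
    H (length f)                  ≡⟨ cong (λ g → count false g ∸ count true g) (take-all (length f) f ≤-refl) ⟩
    count false f ∸ count true f  ≡⟨ cong₂ _∸_ count-false ones ⟩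
    k ∸ k                         ≡⟨ n∸n≡0 k ⟩
    0                             ∎

  height-one : 0 < length f → H 1 ≡ 1
  height-one 0<n with bitAt f 0 in first
  ... | false = height-up 0 0<n first
  ... | true  = ⊥-elim (0≢1+n (height-down 0 0<n first))

  peak-height-positive : ∀ {m} → FirstMaximum H (length f) m → 0 < length f → 0 < H m
  peak-height-positive {m} peak 0<n = subst (_≤ H m) (height-one 0<n) (FirstMaximum.maximal peak 0<n)

  peak-before-end : ∀ {m} → FirstMaximum H (length f) m → 0 < H m → m < length f
  peak-before-end peak 0<Hm =
    ≤∧≢⇒< (FirstMaximum.bounded peak) (λ { refl → <-irrefl (sym height-end) 0<Hm })

  module Peak {i : ℕ} (peak : FirstMaximum H (length f) (suc i)) (peak<n : suc i < length f) where
    open FirstMaximum peak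

    i<n : i < length f
    i<n = <-trans (n<1+n i) peak<n

    ascent : bitAt f i ≡ false
    ascent with bitAt f i in bit
    ... | false = refl
    ... | true  = ⊥-elim (<-asym (first (n<1+n i)) (subst (H (suc i) <_) (sym (height-down i i<n bit)) (n<1+n _)))

    descent : bitAt f (suc i) ≡ true
    descent with bitAt f (suc i) in bit
    ... | true  = refl
    ... | false = ⊥-elim (1+n≰n (subst (_≤ H (suc i)) (height-up (suc i) peak<n bit) (maximal peak<n)))

    nest-ascent : nest f i ≡ count false f
    nest-ascent = trans (nest-lastOfItsType f i last) (cong (λ b → count b f) ascent)
      where
      last : LastOfItsType f i
      last j j<n same rewrite layer-up f j (trans same ascent) | layer-up f i ascent = below , tie
        where
        rise-j = height-up j j<n (trans same ascent)
        rise-i = height-up i i<n ascent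
        below : H j ≤ H i
        below = s≤s⁻¹ (subst₂ _≤_ rise-j rise-i (maximal j<n))
        tie : H j ≡ H i → i ≤ j
        tie e = s≤s⁻¹ (≡-max⇒≥ (trans rise-j (trans (cong suc e) (sym rise-i))))

    nest-descent : nest f (suc i) ≡ count true f
    nest-descent = trans (nest-lastOfItsType f (suc i) last) (cong (λ b → count b f) descent)
      where
      last : LastOfItsType f (suc i)
      last j j<n same rewrite layer-down j j<n (trans same descent) | layer-down (suc i) peak<n descent = below , tie
        where
        fall-j = height-down j j<n (trans same descent)
        fall-peak = height-down (suc i) peak<n descent
        below : H (suc j) ≤ H (suc (suc i))
        below = s≤s⁻¹ (subst₂ _≤_ fall-j fall-peak (maximal (<⇒≤ j<n)))
        tie : H (suc j) ≡ H (suc (suc i)) → suc i ≤ j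
        tie e = ≡-max⇒≥ (trans fall-j (trans (cong suc e) (sym fall-peak)))

lemma21 : (k : ℕ) → 1 ≤ k → (f : List Bool) → IsDyckWord k f →
    ∃ λ i → (suc i < 2 * k) × (nest f i ≡ k) × (nest f (suc i) ≡ k)
lemma21 k 1≤k f dw = atPeak (firstMaximum H (length f))
  where
  open IsDyckWord dw
  open DyckPath dw

  0<n : 0 < length f
  0<n = subst (0 <_) (sym len) (≤-trans 1≤k (m≤m+n k _))

  atPeak : ∃ (FirstMaximum H (length f)) → ∃ λ i → (suc i < 2 * k) × (nest f i ≡ k) × (nest f (suc i) ≡ k)
  atPeak (zero  , peak) = ⊥-elim (<-irrefl refl (peak-height-positive peak 0<n))
  atPeak (suc i , peak) = i , subst (suc i <_) len peak<n , trans nest-ascent count-false , trans nest-descent ones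
    where
    peak<n = peak-before-end peak (peak-height-positive peak 0<n)
    open Peak peak peak<n
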